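{- Let $\mathcal{C}$ be a category, let $R,S,T$ be monads on $\mathcal{C}$, let $\lambda \colon TS \Rightarrow ST$ be a weak distributive law, and let $\sigma \colon SR \Rightarrow RS$ and $\tau \colon TR \Rightarrow RT$ be natural transformations. Assume $\tau$ satisfies $\tau \circ \eta^T R = R\eta^T$ and $\tau \circ \mu^T R = R\mu^T \circ \tau T \circ T\tau$, and assume the Yang–Baxter equation $\sigma T \circ S\tau \circ \lambda R = R\lambda \circ \tau S \circ T\sigma$ holds. Let $\kappa^\lambda \triangleq S\mu^T \circ \lambda T \circ \eta^T ST \colon ST \Rightarrow ST$. Then $$R\kappa^\lambda \circ \sigma T \circ S\tau = \sigma T \circ S\tau \circ \kappa^\lambda R.$$
   Context: A monad is $(T,\eta^T,\mu^T)$. For monads $S,T$, a natural transformation $\lambda \colon TS \Rightarrow ST$ is a weak distributive law if $\lambda \circ T\eta^S = \eta^S T$, $\lambda \circ T\mu^S = \mu^S T \circ S\lambda \circ \lambda S$, and $\lambda \circ \mu^T S = S\mu^T \circ \lambda T \circ T\lambda$. -}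

module Defs where

open import Level using (Level; _⊔_; suc)
open import Relation.Binary using (IsEquivalence)

record Category (o ℓ e : Level) : Set (suc (o ⊔ ℓ ⊔ e)) where
  infix  4 _≈_
  infixr 9 _∘_
  field
    Obj   : Set o
    _⇒_   : Obj → Obj → Set ℓ
    _≈_   : ∀ {A B} → A ⇒ B → A ⇒ B → Set e
    id    : ∀ {A} → A ⇒ A
    _∘_   : ∀ {A B C} → B ⇒ C → A ⇒ B → A ⇒ C
    assoc     : ∀ {A B C D} {f : A ⇒ B} {g : B ⇒ C} {h : C ⇒ D} →
                (h ∘ g) ∘ f ≈ h ∘ (g ∘ f)
    identityˡ : ∀ {A B} {f : A ⇒ B} → id ∘ f ≈ f
    identityʳ : ∀ {A B} {f : A ⇒ B} → f ∘ id ≈ f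
    equiv     : ∀ {A B} → IsEquivalence (_≈_ {A} {B})
    ∘-resp-≈  : ∀ {A B C} {f h : B ⇒ C} {g i : A ⇒ B} →
                f ≈ h → g ≈ i → f ∘ g ≈ h ∘ i

module _ {o ℓ e : Level} (C : Category o ℓ e) where
  open Category C

  record Endofunctor : Set (o ⊔ ℓ ⊔ e) where
    field
      F₀ : Obj → Obj
      F₁ : ∀ {A B} → A ⇒ B → F₀ A ⇒ F₀ B
      identity     : ∀ {A} → F₁ (id {A}) ≈ id
      homomorphism : ∀ {A B D} {f : A ⇒ B} {g : B ⇒ D} →
                     F₁ (g ∘ f) ≈ F₁ g ∘ F₁ f
      F-resp-≈     : ∀ {A B} {f g : A ⇒ B} → f ≈ g → F₁ f ≈ F₁ g

  _∘F_ : Endofunctor → Endofunctor → Endofunctor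
  F ∘F G = record
    { F₀ = λ X → F.F₀ (G.F₀ X)
    ; F₁ = λ f → F.F₁ (G.F₁ f)
    ; identity = trans (F.F-resp-≈ G.identity) F.identity
    ; homomorphism = trans (F.F-resp-≈ G.homomorphism) F.homomorphism
    ; F-resp-≈ = λ p → F.F-resp-≈ (G.F-resp-≈ p)
    }
    where
      module F = Endofunctor F
      module G = Endofunctor G
      trans : ∀ {A B} {f g h : A ⇒ B} → f ≈ g → g ≈ h → f ≈ h
      trans = IsEquivalence.trans equiv

  IdF : Endofunctor
  IdF = record
    { F₀ = λ X → X ; F₁ = λ f → f
    ; identity = IsEquivalence.refl equiv
    ; homomorphism = IsEquivalence.refl equiv
    ; F-resp-≈ = λ p → p }

  record NatTrans (F G : Endofunctor) : Set (o ⊔ ℓ ⊔ e) where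
    private
      module F = Endofunctor F
      module G = Endofunctor G
    field
      η       : ∀ X → F.F₀ X ⇒ G.F₀ X
      commute : ∀ {X Y} (f : X ⇒ Y) → η Y ∘ F.F₁ f ≈ G.F₁ f ∘ η X

  record Monad : Set (o ⊔ ℓ ⊔ e) where
    field
      F : Endofunctor
      η : NatTrans IdF F
      μ : NatTrans (F ∘F F) F
    open Endofunctor F public
    private
      module η = NatTrans η
      module μ = NatTrans μ
    field
      assoc     : ∀ {X} → μ.η X ∘ F₁ (μ.η X) ≈ μ.η X ∘ μ.η (F₀ X)
      identityˡ : ∀ {X} → μ.η X ∘ F₁ (η.η X) ≈ id
      identityʳ : ∀ {X} → μ.η X ∘ η.η (F₀ X) ≈ id

  module _ (S T : Monad) where
    private
      module S = Monad S
      module T = Monad T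
      module ηS = NatTrans S.η
      module μS = NatTrans S.μ
      module ηT = NatTrans T.η
      module μT = NatTrans T.μ

    -- Weak distributive law λ : TS ⇒ ST (the three axioms of the paper;
    -- no unit axiom for η^T).
    record IsWeakDistributiveLaw (l : NatTrans (T.F ∘F S.F) (S.F ∘F T.F))
        : Set (o ⊔ e) where
      private module l = NatTrans l
      field
        unitS : ∀ X → l.η X ∘ T.F₁ (ηS.η X) ≈ ηS.η (T.F₀ X)
        multS : ∀ X → l.η X ∘ T.F₁ (μS.η X)
                      ≈ μS.η (T.F₀ X) ∘ (S.F₁ (l.η X) ∘ l.η (S.F₀ X))
        multT : ∀ X → l.η X ∘ μT.η (S.F₀ X)
                      ≈ S.F₁ (μT.η X) ∘ (l.η (T.F₀ X) ∘ T.F₁ (l.η X))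

    kappa : NatTrans (T.F ∘F S.F) (S.F ∘F T.F) → ∀ X →
            S.F₀ (T.F₀ X) ⇒ S.F₀ (T.F₀ X)
    kappa l X = S.F₁ (μT.η X) ∘ (NatTrans.η l (T.F₀ X) ∘ ηT.η (S.F₀ (T.F₀ X)))

{-# OPTIONS --safe #-}
-- Write ρ = σT ∘ Sτ : STR ⇒ RST. Sliding ρ from right to left through
-- κ^λ = Sμ^T ∘ λT ∘ η^T ST moves it past one factor at a time: past Sμ^T by
-- the multiplication law of τ and naturality of σ, past λ by naturality of λ
-- and the Yang–Baxter equation, and past η^T by naturality of η^T and the unit
-- law of τ. What remains is Rκ^λ ∘ ρ.
module Submission where

open import Level using (Level)
open import Relation.Binary using (IsEquivalence; Setoid)
import Relation.Binary.Reasoning.Setoid as SetoidReasoning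
open import Defs

module MorphismReasoning {o ℓ e : Level} (C : Category o ℓ e) where
  open Category C

  module Equiv {A B : Obj} = IsEquivalence (equiv {A} {B})
  open Equiv public using (refl; sym; trans)

  hom-setoid : Obj → Obj → Setoid ℓ e
  hom-setoid A B = record { Carrier = A ⇒ B ; _≈_ = _≈_ ; isEquivalence = equiv }

  module HomReasoning {A B : Obj} = SetoidReasoning (hom-setoid A B)
  open HomReasoning public

  infixr 4 refl⟩∘⟨_
  refl⟩∘⟨_ : ∀ {A B D} {f : B ⇒ D} {g h : A ⇒ B} → g ≈ h → f ∘ g ≈ f ∘ h
  refl⟩∘⟨ p = ∘-resp-≈ refl p

  assoc² : ∀ {A B D E F} {a : E ⇒ F} {b : D ⇒ E} {c : B ⇒ D} {f : A ⇒ B} →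
           (a ∘ (b ∘ c)) ∘ f ≈ a ∘ (b ∘ (c ∘ f))
  assoc² = trans assoc (refl⟩∘⟨ assoc)

  extend₁₃ : ∀ {A B D E F} {g : B ⇒ F} {a : E ⇒ F} {b : D ⇒ E} {c : B ⇒ D}
             {f : A ⇒ B} → g ≈ a ∘ (b ∘ c) → g ∘ f ≈ a ∘ (b ∘ (c ∘ f))
  extend₁₃ p = trans (∘-resp-≈ p refl) assoc²

  extend₂₂ : ∀ {A B D D′ E} {a : D ⇒ E} {b : B ⇒ D} {c : D′ ⇒ E} {d : B ⇒ D′}
             {f : A ⇒ B} → a ∘ b ≈ c ∘ d → a ∘ (b ∘ f) ≈ c ∘ (d ∘ f)
  extend₂₂ p = trans (sym assoc) (trans (∘-resp-≈ p refl) assoc)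

  extend₂₃ : ∀ {A B D E E′ F} {a : D ⇒ F} {b : B ⇒ D} {c : E′ ⇒ F} {d : E ⇒ E′}
             {g : B ⇒ E} {f : A ⇒ B} →
             a ∘ b ≈ c ∘ (d ∘ g) → a ∘ (b ∘ f) ≈ c ∘ (d ∘ (g ∘ f))
  extend₂₃ p = trans (sym assoc) (extend₁₃ p)

  extend₃₂ : ∀ {A B D D′ E F} {a : E ⇒ F} {b : D ⇒ E} {c : B ⇒ D} {d : D′ ⇒ F}
             {g : B ⇒ D′} {f : A ⇒ B} →
             a ∘ (b ∘ c) ≈ d ∘ g → a ∘ (b ∘ (c ∘ f)) ≈ d ∘ (g ∘ f)
  extend₃₂ p = trans (sym assoc²) (trans (∘-resp-≈ p refl) assoc)

  extend₃₃ : ∀ {A B D D′ E E′ F} {a : E ⇒ F} {b : D ⇒ E} {c : B ⇒ D}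
             {d : E′ ⇒ F} {g : D′ ⇒ E′} {h : B ⇒ D′} {f : A ⇒ B} →
             a ∘ (b ∘ c) ≈ d ∘ (g ∘ h) → a ∘ (b ∘ (c ∘ f)) ≈ d ∘ (g ∘ (h ∘ f))
  extend₃₃ p = trans (sym assoc²) (extend₁₃ p)

module EndofunctorProperties {o ℓ e : Level} {C : Category o ℓ e}
                             (F : Endofunctor C) where
  open Category C
  open MorphismReasoning C
  open Endofunctor F public

  homomorphism₃ : ∀ {A B D E} {a : D ⇒ E} {b : B ⇒ D} {c : A ⇒ B} →
                  F₁ (a ∘ (b ∘ c)) ≈ F₁ a ∘ (F₁ b ∘ F₁ c)
  homomorphism₃ = trans homomorphism (refl⟩∘⟨ homomorphism)

  F-resp-∘₂₃ : ∀ {A D E E′ G} {a : D ⇒ G} {b : A ⇒ D} {c : E′ ⇒ G} {d : E ⇒ E′}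
               {g : A ⇒ E} → a ∘ b ≈ c ∘ (d ∘ g) →
               F₁ a ∘ F₁ b ≈ F₁ c ∘ (F₁ d ∘ F₁ g)
  F-resp-∘₂₃ p = trans (sym homomorphism) (trans (F-resp-≈ p) homomorphism₃)

module _ {o ℓ e : Level} {C : Category o ℓ e} {R : Endofunctor C} (T : Monad C)
         (τ : NatTrans C (_∘F_ C (Monad.F T) R) (_∘F_ C R (Monad.F T))) where
  open Category C
  open MorphismReasoning C
  private
    module R = Endofunctor R
    module T = Monad T
    module τ = NatTrans τ
    module ηᵀ = NatTrans T.η

  τ∘T[f]∘η≈Rη∘f : (∀ X → τ.η X ∘ ηᵀ.η (R.F₀ X) ≈ R.F₁ (ηᵀ.η X)) →
                  ∀ {A B} (f : A ⇒ R.F₀ B) →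
                  τ.η B ∘ (T.F₁ f ∘ ηᵀ.η A) ≈ R.F₁ (ηᵀ.η B) ∘ f
  τ∘T[f]∘η≈Rη∘f τ-unit f =
    trans (refl⟩∘⟨ sym (ηᵀ.commute f)) (trans (sym assoc) (∘-resp-≈ (τ-unit _) refl))

lemma4p4 : ∀ {o ℓ e : Level} (C : Category o ℓ e) (R S T : Monad C)
    (l : NatTrans C (_∘F_ C (Monad.F T) (Monad.F S)) (_∘F_ C (Monad.F S) (Monad.F T)))
    → IsWeakDistributiveLaw C S T l
    → (σ : NatTrans C (_∘F_ C (Monad.F S) (Monad.F R)) (_∘F_ C (Monad.F R) (Monad.F S)))
    → (τ : NatTrans C (_∘F_ C (Monad.F T) (Monad.F R)) (_∘F_ C (Monad.F R) (Monad.F T)))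
    → (∀ X → Category._≈_ C (Category._∘_ C (NatTrans.η τ X) (NatTrans.η (Monad.η T) (Monad.F₀ R X))) (Monad.F₁ R (NatTrans.η (Monad.η T) X)))
    → (∀ X → Category._≈_ C (Category._∘_ C (NatTrans.η τ X) (NatTrans.η (Monad.μ T) (Monad.F₀ R X))) (Category._∘_ C (Monad.F₁ R (NatTrans.η (Monad.μ T) X)) (Category._∘_ C (NatTrans.η τ (Monad.F₀ T X)) (Monad.F₁ T (NatTrans.η τ X)))))
    → (∀ X → Category._≈_ C (Category._∘_ C (NatTrans.η σ (Monad.F₀ T X)) (Category._∘_ C (Monad.F₁ S (NatTrans.η τ X)) (NatTrans.η l (Monad.F₀ R X)))) (Category._∘_ C (Monad.F₁ R (NatTrans.η l X)) (Category._∘_ C (NatTrans.η τ (Monad.F₀ S X)) (Monad.F₁ T (NatTrans.η σ X)))))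
    → ∀ X → Category._≈_ C (Category._∘_ C (Monad.F₁ R (kappa C S T l X)) (Category._∘_ C (NatTrans.η σ (Monad.F₀ T X)) (Monad.F₁ S (NatTrans.η τ X)))) (Category._∘_ C (NatTrans.η σ (Monad.F₀ T X)) (Category._∘_ C (Monad.F₁ S (NatTrans.η τ X)) (kappa C S T l (Monad.F₀ R X))))
lemma4p4 C R S T l _ σ τ τ-unit τ-mult yang-baxter X = sym (begin
    σ.η (T.F₀ X) ∘ (S.F₁ (τ.η X) ∘ (S.F₁ (μᵀ.η (R.F₀ X)) ∘ (l.η (T.F₀ (R.F₀ X)) ∘ ηᵀ.η _)))
  ≈⟨ refl⟩∘⟨ extend₂₃ (S.F-resp-∘₂₃ (τ-mult X)) ⟩
    σ.η (T.F₀ X) ∘ (S.F₁ (R.F₁ (μᵀ.η X)) ∘ (S.F₁ (τ.η (T.F₀ X)) ∘ (S.F₁ (T.F₁ (τ.η X)) ∘ (l.η _ ∘ ηᵀ.η _))))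
  ≈⟨ extend₂₂ (σ.commute (μᵀ.η X)) ⟩
    R.F₁ (S.F₁ (μᵀ.η X)) ∘ (σ.η _ ∘ (S.F₁ (τ.η (T.F₀ X)) ∘ (S.F₁ (T.F₁ (τ.η X)) ∘ (l.η _ ∘ ηᵀ.η _))))
  ≈˘⟨ refl⟩∘⟨ refl⟩∘⟨ refl⟩∘⟨ extend₂₂ (l.commute (τ.η X)) ⟩
    R.F₁ (S.F₁ (μᵀ.η X)) ∘ (σ.η _ ∘ (S.F₁ (τ.η (T.F₀ X)) ∘ (l.η _ ∘ (T.F₁ (S.F₁ (τ.η X)) ∘ ηᵀ.η _))))
  ≈˘⟨ refl⟩∘⟨ refl⟩∘⟨ refl⟩∘⟨ refl⟩∘⟨ ηᵀ.commute (S.F₁ (τ.η X)) ⟩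
    R.F₁ (S.F₁ (μᵀ.η X)) ∘ (σ.η _ ∘ (S.F₁ (τ.η (T.F₀ X)) ∘ (l.η _ ∘ (ηᵀ.η _ ∘ S.F₁ (τ.η X)))))
  ≈⟨ refl⟩∘⟨ extend₃₃ (yang-baxter (T.F₀ X)) ⟩
    R.F₁ (S.F₁ (μᵀ.η X)) ∘ (R.F₁ (l.η (T.F₀ X)) ∘ (τ.η _ ∘ (T.F₁ (σ.η _) ∘ (ηᵀ.η _ ∘ S.F₁ (τ.η X)))))
  ≈⟨ refl⟩∘⟨ refl⟩∘⟨ extend₃₂ (τ∘T[f]∘η≈Rη∘f T τ τ-unit (σ.η (T.F₀ X))) ⟩
    R.F₁ (S.F₁ (μᵀ.η X)) ∘ (R.F₁ (l.η (T.F₀ X)) ∘ (R.F₁ (ηᵀ.η _) ∘ (σ.η (T.F₀ X) ∘ S.F₁ (τ.η X))))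
  ≈˘⟨ extend₁₃ R.homomorphism₃ ⟩
    R.F₁ (kappa C S T l X) ∘ (σ.η (T.F₀ X) ∘ S.F₁ (τ.η X))
  ∎)
  where
    open Category C
    open MorphismReasoning C
    module R = EndofunctorProperties (Monad.F R)
    module S = EndofunctorProperties (Monad.F S)
    module T = Monad T
    module l = NatTrans l
    module σ = NatTrans σ
    module τ = NatTrans τ
    module ηᵀ = NatTrans T.η
    module μᵀ = NatTrans T.μ
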